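{- Let $m\ge 1$, $n\ge 0$ and $0\le k\le \min(m,n)$. The number of words of length $n$ on $\{1,\dots,m\}$ that avoid both generalized patterns $1-12$ and $2-21$ and have exactly $k$ distinct letters is \[ \begin{cases} k\cdot (m)_k, & k<n,\\ (m)_n, & k=n,\end{cases} \] where $(a)_b=a(a-1)\cdots(a-b+1)$ denotes the falling factorial (with $(a)_0=1$).
   Context: A word of length $n$ on $\{1,\dots,m\}$ (naturally ordered) is a sequence $w_1\cdots w_n$ of elements of $\{1,\dots,m\}$. A word $w$ contains the generalized pattern $1-12$ iff there exist indices $1\le i<j<n$ with $w_i=w_j<w_{j+1}$, and contains $2-21$ iff there exist $i<j<n$ with $w_i=w_j>w_{j+1}$; it avoids a pattern if it does not contain it. -}

module Defs where

open import Data.Nat using (ℕ; zero; suc; _*_; _∸_)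
open import Data.Nat.Base as ℕ using ()
open import Data.Fin using (Fin; toℕ) renaming (_<_ to _<ᶠ_)
open import Data.Fin.Properties using (_≟_)
open import Data.Vec using (Vec; lookup; toList)
open import Data.List using (List; length; deduplicate)
open import Data.List.Membership.Propositional using (_∈_)
open import Data.List.Relation.Unary.Unique.Propositional using (Unique)
open import Data.Product using (Σ; ∃; _×_)
open import Function.Bundles using (_⇔_)
open import Relation.Binary.PropositionalEquality using (_≡_)
open import Relation.Nullary using (¬_)

-- A word of length n on the alphabet {1,…,m}, letters encoded as Fin m
-- (order-preserving: letter a ↦ a-1).
Word : ℕ → ℕ → Set
Word m n = Vec (Fin m) n

Contains1-12 : ∀ {m n} → Word m n → Set
Contains1-12 {m} {n} w =
  Σ (Fin n) λ i → Σ (Fin n) λ j → Σ (Fin n) λ j′ →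
    (toℕ i ℕ.< toℕ j) × (toℕ j′ ≡ suc (toℕ j)) ×
    (lookup w i ≡ lookup w j) × (lookup w j <ᶠ lookup w j′)

Contains2-21 : ∀ {m n} → Word m n → Set
Contains2-21 {m} {n} w =
  Σ (Fin n) λ i → Σ (Fin n) λ j → Σ (Fin n) λ j′ →
    (toℕ i ℕ.< toℕ j) × (toℕ j′ ≡ suc (toℕ j)) ×
    (lookup w i ≡ lookup w j) × (lookup w j′ <ᶠ lookup w j)

distinctLetters : ∀ {m n} → Word m n → ℕ
distinctLetters w = length (deduplicate _≟_ (toList w))

Good : (m n k : ℕ) → Word m n → Set
Good m n k w = ¬ Contains1-12 w × ¬ Contains2-21 w × (distinctLetters w ≡ k)

HasCount : {A : Set} → (A → Set) → ℕ → Set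
HasCount {A} P N =
  Σ (List A) λ L → Unique L × (∀ x → (x ∈ L) ⇔ P x) × (length L ≡ N)

fall : ℕ → ℕ → ℕ
fall a zero = 1
fall a (suc b) = fall a b * (a ∸ b)

-- A word avoids both patterns iff every letter that has already occurred
-- earlier is immediately followed by the same letter ("stable" words).
-- Consequently a good word is a prefix u of pairwise distinct letters,
-- optionally followed by a run x x ⋯ x of one letter x of u that lasts to
-- the end of the word.  If the word has k distinct letters then u has
-- length k, so:
--   * for n = k the good words are exactly the injective words, (m)_k many;
--   * for n = k + (r+1) they are exactly the words d ++ x^(r+1) with d
--     injective of length k and x a letter of d, k·(m)_k many.
module Submission where

open import Defs
open import Data.Nat using (ℕ; zero; suc; _+_; _*_; _∸_; _≤_; _<_; z≤n; s≤s)
open import Data.Nat.Properties using (+-suc; *-comm; suc-injective; m+1+n≢m; m+n∸m≡n; m≤n⇒∃[o]m+o≡n)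
open import Data.Fin using (Fin; zero; suc; toℕ)
open import Data.Fin.Properties using (_≟_; <-cmp; <-irrefl)
open import Data.Vec as V using (Vec; []; _∷_; lookup; toList; splitAt)
import Data.Vec.Properties as VP
open import Data.List as L using (List; []; _∷_; _++_; length; filter; allFin; concatMap; replicate)
import Data.List.Properties as LP
open import Data.List.Relation.Unary.All as All using (All; []; _∷_)
open import Data.List.Relation.Unary.All.Properties using (¬Any⇒All¬; All¬⇒¬Any; replicate⁺)
open import Data.List.Relation.Unary.Any using (here; there)
open import Data.List.Relation.Unary.AllPairs using ([]; _∷_)
open import Data.List.Relation.Unary.Unique.Propositional using (Unique)
open import Data.List.Relation.Unary.Unique.Propositional.Properties using (map⁺; ++⁺; filter⁺; allFin⁺)
open import Data.List.Relation.Unary.Unique.DecPropositional.Properties using (deduplicate-!)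
open import Data.List.Membership.Propositional using (_∈_; _∉_; find; lose)
open import Data.List.Membership.Propositional.Properties
  using (∈-map⁺; ∈-map⁻; ∈-++⁺ˡ; ∈-++⁻; ∈-filter⁺; ∈-filter⁻; ∈-allFin; ∈-concatMap⁺; ∈-concatMap⁻; deduplicate-∈⇔)
open import Data.List.Membership.Propositional.Properties.WithK using (unique∧set⇒bag)
open import Data.List.Relation.Binary.BagAndSetEquality using (∼bag⇒↭)
open import Data.List.Relation.Binary.Permutation.Propositional using (↭-sym)
open import Data.List.Relation.Binary.Permutation.Propositional.Properties using (↭-length; ∈-resp-↭; shift)
open import Data.Product using (∃-syntax; _×_; _,_; proj₁; proj₂)
open import Data.Sum using (_⊎_; inj₁; inj₂)
open import Data.Empty using (⊥-elim)
open import Function using (_∘_)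
open import Function.Bundles using (_⇔_; mk⇔)
import Function.Properties.Equivalence as ⇔
open import Relation.Binary.PropositionalEquality using (_≡_; refl; sym; trans; cong; cong₂; subst; module ≡-Reasoning)
open import Relation.Binary.Definitions using (tri<; tri≈; tri>)
open import Relation.Nullary using (¬_; yes; no; ¬?)
open import Relation.Unary using (Pred; Decidable)
open import Level using (0ℓ)

-- Two duplicate-free lists with the same members are permutations of each
-- other, hence have the same length.  This is how every count is computed.
sameMembers⇒sameLength : {A : Set} {xs ys : List A} → Unique xs → Unique ys →
  (∀ {z} → z ∈ xs ⇔ z ∈ ys) → length xs ≡ length ys
sameMembers⇒sameLength ux uy same = ↭-length (∼bag⇒↭ (unique∧set⇒bag ux uy same))

filter-split-length : {A : Set} {P : Pred A 0ℓ} (P? : Decidable P) (xs : List A) →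
  length (filter P? xs) + length (filter (¬? ∘ P?) xs) ≡ length xs
filter-split-length P? [] = refl
filter-split-length P? (x ∷ xs) with P? x
... | yes _ = cong suc (filter-split-length P? xs)
... | no _ = trans (+-suc _ _) (cong suc (filter-split-length P? xs))

module _ {A B : Set} (f : A → List B) where

  concatMap-length : ∀ xs {c} → (∀ {a} → a ∈ xs → length (f a) ≡ c) →
    length (concatMap f xs) ≡ length xs * c
  concatMap-length [] _ = refl
  concatMap-length (x ∷ xs) blocks =
    trans (LP.length-++ (f x)) (cong₂ _+_ (blocks (here refl)) (concatMap-length xs (blocks ∘ there)))

  concatMap-unique : ∀ {xs} → Unique xs → (∀ {a} → a ∈ xs → Unique (f a)) →
    (∀ {a a′ b} → b ∈ f a → b ∈ f a′ → a ≡ a′) → Unique (concatMap f xs)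
  concatMap-unique {[]} _ _ _ = []
  concatMap-unique {x ∷ xs} (x∉xs ∷ uxs) blocks determined =
    ++⁺ (blocks (here refl)) (concatMap-unique uxs (blocks ∘ there) determined) disjoint
    where
    disjoint : ∀ {b} → ¬ (b ∈ f x × b ∈ concatMap f xs)
    disjoint (b∈fx , b∈rest) with find (∈-concatMap⁻ f b∈rest)
    ... | a , a∈xs , b∈fa = All.lookup x∉xs a∈xs (determined b∈fx b∈fa)

++-cancel-sameLength : {A : Set} (a c : List A) {b e : List A} →
  length a ≡ length c → a ++ b ≡ c ++ e → a ≡ c × b ≡ e
++-cancel-sameLength [] [] _ eq = refl , eq
++-cancel-sameLength (x ∷ a) (y ∷ c) sameLength eq =
  let a≡c , b≡e = ++-cancel-sameLength a c (suc-injective sameLength) (LP.∷-injectiveʳ eq)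
  in cong₂ _∷_ (LP.∷-injectiveˡ eq) a≡c , b≡e

all≡⇒replicate : {A : Set} {y : A} (l : List A) → All (_≡ y) l → l ≡ replicate (length l) y
all≡⇒replicate [] [] = refl
all≡⇒replicate (_ ∷ l) (z≡y ∷ rest) = cong₂ _∷_ z≡y (all≡⇒replicate l rest)

toList-injective-≡ : {A : Set} {n : ℕ} (xs ys : Vec A n) → toList xs ≡ toList ys → xs ≡ ys
toList-injective-≡ xs ys eq = trans (sym (VP.cast-is-id refl xs)) (VP.toList-injective refl xs ys eq)

module Words (m : ℕ) where
  open import Data.List.Membership.DecPropositional (_≟_ {m}) using (_∈?_)
  open ≡-Reasoning

  Letter : Set
  Letter = Fin m

  -- The letter at position j of v has been seen before: it belongs to the
  -- list s of letters read before v, or occurs at an earlier position of v.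
  Seen : ∀ {n} → List Letter → Vec Letter n → Fin n → Set
  Seen s v j = lookup v j ∈ s ⊎ ∃[ i ] (toℕ i < toℕ j × lookup v i ≡ lookup v j)

  Stable : ∀ {n} → List Letter → Vec Letter n → Set
  Stable {n} s v = ∀ (j j′ : Fin n) → toℕ j′ ≡ suc (toℕ j) → Seen s v j → lookup v j ≡ lookup v j′

  -- A good word is stable: a repeated letter followed by a larger (smaller)
  -- letter would be an occurrence of 1-12 (of 2-21).
  good⇒stable : ∀ {n k} (w : Word m n) → Good m n k w → Stable [] w
  good⇒stable w _ j j′ _ (inj₁ ())
  good⇒stable w (no12 , no21 , _) j j′ next (inj₂ (i , i<j , wi≡wj)) with <-cmp (lookup w j) (lookup w j′)
  ... | tri< wj<wj′ _ _ = ⊥-elim (no12 (i , j , j′ , i<j , next , wi≡wj , wj<wj′))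
  ... | tri≈ _ wj≡wj′ _ = wj≡wj′
  ... | tri> _ _ wj′<wj = ⊥-elim (no21 (i , j , j′ , i<j , next , wi≡wj , wj′<wj))

  stable⇒avoids : ∀ {n} (w : Word m n) → Stable [] w → ¬ Contains1-12 w × ¬ Contains2-21 w
  stable⇒avoids w stable =
    (λ (i , j , j′ , i<j , next , wi≡wj , wj<wj′) → <-irrefl (stable j j′ next (inj₂ (i , i<j , wi≡wj))) wj<wj′) ,
    (λ (i , j , j′ , i<j , next , wi≡wj , wj′<wj) → <-irrefl (sym (stable j j′ next (inj₂ (i , i<j , wi≡wj)))) wj′<wj)

  seen-tail : ∀ {n s y} {v : Vec Letter n} {j} → Seen (y ∷ s) v j → Seen s (y ∷ v) (suc j)
  seen-tail (inj₁ (here wj≡y)) = inj₂ (zero , s≤s z≤n , sym wj≡y)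
  seen-tail (inj₁ (there wj∈s)) = inj₁ wj∈s
  seen-tail (inj₂ (i , i<j , wi≡wj)) = inj₂ (suc i , s≤s i<j , wi≡wj)

  seen-untail : ∀ {n s y} {v : Vec Letter n} {j} → Seen s (y ∷ v) (suc j) → Seen (y ∷ s) v j
  seen-untail (inj₁ wj∈s) = inj₁ (there wj∈s)
  seen-untail (inj₂ (zero , _ , y≡wj)) = inj₁ (here (sym y≡wj))
  seen-untail (inj₂ (suc i , s≤s i<j , wi≡wj)) = inj₂ (i , i<j , wi≡wj)

  stable-tail : ∀ {n s y} {v : Vec Letter n} → Stable s (y ∷ v) → Stable (y ∷ s) v
  stable-tail stable j j′ next seen = stable (suc j) (suc j′) (cong suc next) (seen-tail seen)

  stable-run : ∀ {n} s y (v : Vec Letter n) → Stable s (y ∷ v) → y ∈ s → All (_≡ y) (toList v)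
  stable-run s y [] _ _ = []
  stable-run s y (z ∷ v) stable y∈s with refl ← stable zero (suc zero) refl (inj₁ y∈s) =
    refl ∷ stable-run (y ∷ s) y v (stable-tail stable) (here refl)

  data Form (s : List Letter) : List Letter → Set where
    []    : Form s []
    fresh : ∀ {y l} → y ∉ s → Form (y ∷ s) l → Form s (y ∷ l)
    stall : ∀ {y l} → y ∈ s → All (_≡ y) l → Form s (y ∷ l)

  lookup-run : ∀ {n} {y} (v : Vec Letter n) → All (_≡ y) (toList v) → ∀ j → lookup (y ∷ v) j ≡ y
  lookup-run v _ zero = refl
  lookup-run (z ∷ v) (z≡y ∷ _) (suc zero) = z≡y
  lookup-run (z ∷ v) (_ ∷ rest) (suc (suc j)) = lookup-run v rest (suc j)

  stable⇒form : ∀ {n} s (v : Vec Letter n) → Stable s v → Form s (toList v)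
  stable⇒form s [] _ = []
  stable⇒form s (y ∷ v) stable with y ∈? s
  ... | yes y∈s = stall y∈s (stable-run s y v stable y∈s)
  ... | no y∉s = fresh y∉s (stable⇒form (y ∷ s) v (stable-tail stable))

  form⇒stable : ∀ {n} s (v : Vec Letter n) → Form s (toList v) → Stable s v
  form⇒stable s [] _ ()
  form⇒stable s (y ∷ v) (stall _ constant) j j′ _ _ = trans (lookup-run v constant j) (sym (lookup-run v constant j′))
  form⇒stable s (y ∷ v) (fresh _ _) zero zero () _
  form⇒stable s (y ∷ v) (fresh y∉s _) zero (suc _) _ (inj₁ y∈s) = ⊥-elim (y∉s y∈s)
  form⇒stable s (y ∷ v) (fresh _ _) zero (suc _) _ (inj₂ (_ , () , _))
  form⇒stable s (y ∷ v) (fresh _ _) (suc _) zero () _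
  form⇒stable s (y ∷ v) (fresh _ form) (suc j) (suc j′) next seen =
    form⇒stable (y ∷ s) v form j j′ (suc-injective next) (seen-untail seen)

  Fresh : List Letter → List Letter → Set
  Fresh s u = Unique u × All (_∉ s) u

  fresh-∷⁺ : ∀ {s u y} → y ∉ s → Fresh (y ∷ s) u → Fresh s (y ∷ u)
  fresh-∷⁺ y∉s (uu , new) =
    All.map (λ z∉ys y≡z → z∉ys (here (sym y≡z))) new ∷ uu , y∉s ∷ All.map (_∘ there) new

  fresh-∷⁻ : ∀ {s u y} → Fresh s (y ∷ u) → y ∉ s × Fresh (y ∷ s) u
  fresh-∷⁻ (y∉u ∷ uu , y∉s ∷ new) = y∉s , uu , All.zipWith notInCons (y∉u , new)
    where
    notInCons : ∀ {y z s} → (¬ y ≡ z) × z ∉ s → z ∉ y ∷ s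
    notInCons (y≢z , _) (here z≡y) = y≢z (sym z≡y)
    notInCons (_ , z∉s) (there z∈s) = z∉s z∈s

  fresh[] : ∀ {u} → Unique u → Fresh [] u
  fresh[] uu = uu , All.tabulate (λ _ ())

  data Shape (s l : List Letter) : Set where
    distinct : Fresh s l → Shape s l
    runOf    : (u : List Letter) (x : Letter) (r : ℕ) → Fresh s u → x ∈ s ++ u →
               l ≡ u ++ x ∷ replicate r x → Shape s l

  -- Unfolding the normal form; the seen letter x is shifted into u as
  -- fresh letters are consumed.
  form⇒shape : ∀ s l → Form s l → Shape s l
  form⇒shape s [] [] = distinct ([] , [])
  form⇒shape s (y ∷ l) (stall y∈s constant) =
    runOf [] y (length l) ([] , []) (∈-++⁺ˡ y∈s) (cong (y ∷_) (all≡⇒replicate l constant))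
  form⇒shape s (y ∷ l) (fresh y∉s form) with form⇒shape (y ∷ s) l form
  ... | distinct fr = distinct (fresh-∷⁺ y∉s fr)
  ... | runOf u x r fr x∈ l≡ =
    runOf (y ∷ u) x r (fresh-∷⁺ y∉s fr) (∈-resp-↭ (↭-sym (shift y s u)) x∈) (cong (y ∷_) l≡)

  fresh⇒form : ∀ {s} u → Fresh s u → Form s u
  fresh⇒form [] _ = []
  fresh⇒form (y ∷ u) fr = let y∉s , fr′ = fresh-∷⁻ fr in fresh y∉s (fresh⇒form u fr′)

  run⇒form : ∀ {s} u x r → Fresh s u → x ∈ s ++ u → Form s (u ++ x ∷ replicate r x)
  run⇒form {s} [] x r _ x∈s = stall (subst (x ∈_) (LP.++-identityʳ s) x∈s) (replicate⁺ r refl)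
  run⇒form {s} (y ∷ u) x r fr x∈ =
    let y∉s , fr′ = fresh-∷⁻ fr in fresh y∉s (run⇒form u x r fr′ (∈-resp-↭ (shift y s u) x∈))

  distinctLetters-≡ : ∀ {n} (w : Word m n) {u} → Unique u → (∀ {z} → z ∈ toList w ⇔ z ∈ u) →
    distinctLetters w ≡ length u
  distinctLetters-≡ w uu same =
    sameMembers⇒sameLength (deduplicate-! _≟_ (toList w)) uu (⇔.trans (⇔.sym (deduplicate-∈⇔ _≟_)) same)

  injective-distinctLetters : ∀ {n} (w : Word m n) → Unique (toList w) → distinctLetters w ≡ n
  injective-distinctLetters w uw = trans (distinctLetters-≡ w uw ⇔.refl) (VP.length-toList w)

  run-letters : ∀ {u : List Letter} {x : Letter} r → x ∈ u → ∀ {z} → z ∈ u ++ x ∷ replicate r x ⇔ z ∈ u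
  run-letters {u} {x} r x∈u = mk⇔ to ∈-++⁺ˡ
    where
    to : ∀ {z} → z ∈ u ++ x ∷ replicate r x → z ∈ u
    to z∈ with ∈-++⁻ u z∈
    ... | inj₁ z∈u = z∈u
    ... | inj₂ (here refl) = x∈u
    ... | inj₂ (there z∈run) with refl ← All.lookup (replicate⁺ {P = _≡ x} r refl) z∈run = x∈u

  run-prefix-length : ∀ {n k} (w : Word m n) {u x} r → Good m n k w →
    toList w ≡ u ++ x ∷ replicate r x → Unique u → x ∈ u → length u ≡ k
  run-prefix-length w {u} r (_ , _ , count) w≡ uu x∈u =
    trans (sym (distinctLetters-≡ w uu (λ {z} → subst (λ l → z ∈ l ⇔ z ∈ u) (sym w≡) (run-letters r x∈u)))) count

  good⇒shape : ∀ {n k} (w : Word m n) → Good m n k w → Shape [] (toList w)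
  good⇒shape w good = form⇒shape [] (toList w) (stable⇒form [] w (good⇒stable w good))

  form⇒good : ∀ {n k} (w : Word m n) → Form [] (toList w) → distinctLetters w ≡ k → Good m n k w
  form⇒good w form count = let no12 , no21 = stable⇒avoids w (form⇒stable [] w form) in no12 , no21 , count

  run : ∀ {k} r → Word m k → Letter → Word m (k + suc r)
  run r d x = d V.++ V.replicate (suc r) x

  toList-run : ∀ {k} r (d : Word m k) x → toList (run r d x) ≡ toList d ++ x ∷ replicate r x
  toList-run r d x = trans (VP.toList-++ d _) (cong (toList d ++_) (VP.toList-replicate (suc r) x))

  injective⇒good : ∀ {k} (w : Word m k) → Unique (toList w) → Good m k k w
  injective⇒good w uw = form⇒good w (fresh⇒form (toList w) (fresh[] uw)) (injective-distinctLetters w uw)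

  good⇒injective : ∀ {k} (w : Word m k) → Good m k k w → Unique (toList w)
  good⇒injective {k} w good with good⇒shape w good
  ... | distinct (uw , _) = uw
  ... | runOf u x r (uu , _) x∈u w≡ = ⊥-elim (m+1+n≢m k (sym k≡k+1+r))
    where
    k≡k+1+r : k ≡ k + suc r
    k≡k+1+r = begin
      k                                ≡⟨ sym (VP.length-toList w) ⟩
      length (toList w)                ≡⟨ cong length w≡ ⟩
      length (u ++ x ∷ replicate r x)  ≡⟨ LP.length-++ u ⟩
      length u + suc (length (replicate r x))
        ≡⟨ cong₂ _+_ (run-prefix-length w r good w≡ uu x∈u) (cong suc (LP.length-replicate r)) ⟩
      k + suc r                        ∎

  run⇒good : ∀ {k} r (d : Word m k) x → Unique (toList d) → x ∈ toList d → Good m (k + suc r) k (run r d x)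
  run⇒good r d x ud x∈d = form⇒good (run r d x)
    (subst (Form []) (sym (toList-run r d x)) (run⇒form (toList d) x r (fresh[] ud) x∈d))
    (trans (distinctLetters-≡ (run r d x) ud (λ {z} → subst (λ l → z ∈ l ⇔ z ∈ toList d) (sym (toList-run r d x)) (run-letters r x∈d)))
           (VP.length-toList d))

  good⇒run : ∀ {k} r (w : Word m (k + suc r)) → Good m (k + suc r) k w →
    ∃[ d ] ∃[ x ] Unique (toList d) × x ∈ toList d × w ≡ run r d x
  good⇒run {k} r w good@(_ , _ , count) with good⇒shape w good
  ... | distinct (uw , _) = ⊥-elim (m+1+n≢m k (sym (trans (sym count) (injective-distinctLetters w uw))))
  ... | runOf u x r′ (uu , _) x∈u w≡ with splitAt k w
  ... | d , e , refl =
    d , x , subst Unique (sym d≡u) uu , subst (x ∈_) (sym d≡u) x∈u , cong (d V.++_) e≡run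
    where
    split : toList d ≡ u × toList e ≡ x ∷ replicate r′ x
    split = ++-cancel-sameLength (toList d) u
      (trans (VP.length-toList d) (sym (run-prefix-length (d V.++ e) r′ good w≡ uu x∈u)))
      (trans (sym (VP.toList-++ d e)) w≡)
    d≡u = proj₁ split
    r′≡r : r′ ≡ r
    r′≡r = suc-injective (begin
      suc r′                          ≡⟨ cong suc (sym (LP.length-replicate r′)) ⟩
      length (x ∷ replicate r′ x)     ≡⟨ cong length (sym (proj₂ split)) ⟩
      length (toList e)               ≡⟨ VP.length-toList e ⟩
      suc r                           ∎)
    e≡run : e ≡ V.replicate (suc r) x
    e≡run = toList-injective-≡ e _ (begin
      toList e                        ≡⟨ proj₂ split ⟩
      x ∷ replicate r′ x              ≡⟨ cong (λ t → x ∷ replicate t x) r′≡r ⟩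
      x ∷ replicate r x               ≡⟨ sym (VP.toList-replicate (suc r) x) ⟩
      toList (V.replicate (suc r) x)  ∎)

  freshLetters : ∀ {k} → Word m k → List Letter
  freshLetters d = filter (λ x → ¬? (x ∈? toList d)) (allFin m)

  freshLetters-length : ∀ {k} (d : Word m k) → Unique (toList d) → length (freshLetters d) ≡ m ∸ k
  freshLetters-length {k} d ud = begin
    length (freshLetters d)                  ≡⟨ sym (m+n∸m≡n k _) ⟩
    k + length (freshLetters d) ∸ k          ≡⟨ cong (λ t → t + length (freshLetters d) ∸ k) (sym used) ⟩
    length (filter (_∈? toList d) (allFin m)) + length (freshLetters d) ∸ k
                                             ≡⟨ cong (_∸ k) (filter-split-length (_∈? toList d) (allFin m)) ⟩
    length (allFin m) ∸ k                    ≡⟨ cong (_∸ k) (LP.length-tabulate (λ i → i)) ⟩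
    m ∸ k                                    ∎
    where
    used : length (filter (_∈? toList d) (allFin m)) ≡ k
    used = trans (sameMembers⇒sameLength (filter⁺ _ (allFin⁺ m)) ud
                   (mk⇔ (proj₂ ∘ ∈-filter⁻ (_∈? toList d) {xs = allFin m}) (∈-filter⁺ _ (∈-allFin _))))
                 (VP.length-toList d)

  extensions : ∀ {k} → Word m k → List (Word m (suc k))
  extensions d = L.map (_∷ d) (freshLetters d)

  injectiveWords : ∀ k → List (Word m k)
  injectiveWords zero = [] ∷ []
  injectiveWords (suc k) = concatMap extensions (injectiveWords k)

  injectiveWords-sound : ∀ k (v : Word m k) → v ∈ injectiveWords k → Unique (toList v)
  injectiveWords-sound zero [] _ = []
  injectiveWords-sound (suc k) v v∈ with find (∈-concatMap⁻ extensions {xs = injectiveWords k} v∈)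
  ... | d , d∈ , v∈ext with ∈-map⁻ _ v∈ext
  ... | x , x∈fresh , refl =
    ¬Any⇒All¬ (toList d) (proj₂ (∈-filter⁻ (λ x → ¬? (x ∈? toList d)) {xs = allFin m} x∈fresh)) ∷ injectiveWords-sound k d d∈

  injectiveWords-complete : ∀ k (v : Word m k) → Unique (toList v) → v ∈ injectiveWords k
  injectiveWords-complete zero [] _ = here refl
  injectiveWords-complete (suc k) (x ∷ d) (x∉d ∷ ud) =
    ∈-concatMap⁺ extensions (lose (injectiveWords-complete k d ud)
      (∈-map⁺ (_∷ d) (∈-filter⁺ (λ x → ¬? (x ∈? toList d)) (∈-allFin x) (All¬⇒¬Any x∉d))))

  injectiveWords-unique : ∀ k → Unique (injectiveWords k)
  injectiveWords-unique zero = [] ∷ []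
  injectiveWords-unique (suc k) =
    concatMap-unique extensions (injectiveWords-unique k)
      (λ _ → map⁺ VP.∷-injectiveˡ (filter⁺ _ (allFin⁺ m))) sameTail
    where
    sameTail : ∀ {d d′ : Word m k} {v} → v ∈ extensions d → v ∈ extensions d′ → d ≡ d′
    sameTail v∈ v∈′ with ∈-map⁻ _ v∈ | ∈-map⁻ _ v∈′
    ... | _ , _ , v≡ | _ , _ , v≡′ = VP.∷-injectiveʳ (trans (sym v≡) v≡′)

  injectiveWords-length : ∀ k → length (injectiveWords k) ≡ fall m k
  injectiveWords-length zero = refl
  injectiveWords-length (suc k) = begin
    length (concatMap extensions (injectiveWords k))
      ≡⟨ concatMap-length extensions (injectiveWords k) extensions-length ⟩
    length (injectiveWords k) * (m ∸ k)  ≡⟨ cong (_* (m ∸ k)) (injectiveWords-length k) ⟩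
    fall m k * (m ∸ k)                   ∎
    where
    extensions-length : ∀ {d} → d ∈ injectiveWords k → length (extensions d) ≡ m ∸ k
    extensions-length {d} d∈ =
      trans (LP.length-map (_∷ d) (freshLetters d)) (freshLetters-length d (injectiveWords-sound k d d∈))

  count-injective : ∀ k → HasCount (Good m k k) (fall m k)
  count-injective k =
    injectiveWords k , injectiveWords-unique k ,
    (λ w → mk⇔ (injective⇒good w ∘ injectiveWords-sound k w) (injectiveWords-complete k w ∘ good⇒injective w)) ,
    injectiveWords-length k

  runs : ∀ {k} r → Word m k → List (Word m (k + suc r))
  runs r d = L.map (run r d) (toList d)

  runWords : ∀ k r → List (Word m (k + suc r))
  runWords k r = concatMap (runs r) (injectiveWords k)

  count-run : ∀ k r → HasCount (Good m (k + suc r) k) (k * fall m k)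
  count-run k r = runWords k r , unique , (λ w → mk⇔ (sound w) (complete w)) , size
    where
    unique : Unique (runWords k r)
    unique = concatMap-unique (runs r) (injectiveWords-unique k)
      (λ {d} d∈ → map⁺ (VP.∷-injectiveˡ ∘ VP.++-injectiveʳ d d) (injectiveWords-sound k d d∈))
      (λ {d} {d′} w∈ w∈′ → let _ , _ , w≡ = ∈-map⁻ _ w∈ ; _ , _ , w≡′ = ∈-map⁻ _ w∈′
                           in VP.++-injectiveˡ d d′ (trans (sym w≡) w≡′))
    sound : ∀ w → w ∈ runWords k r → Good m (k + suc r) k w
    sound w w∈ with find (∈-concatMap⁻ (runs r) {xs = injectiveWords k} w∈)
    ... | d , d∈ , w∈runs with ∈-map⁻ _ w∈runs
    ... | x , x∈d , refl = run⇒good r d x (injectiveWords-sound k d d∈) x∈d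
    complete : ∀ w → Good m (k + suc r) k w → w ∈ runWords k r
    complete w good with good⇒run r w good
    ... | d , x , ud , x∈d , refl =
      ∈-concatMap⁺ (runs r) (lose (injectiveWords-complete k d ud) (∈-map⁺ (run r d) x∈d))
    size : length (runWords k r) ≡ k * fall m k
    size = begin
      length (runWords k r)
        ≡⟨ concatMap-length (runs r) (injectiveWords k)
             (λ {d} _ → trans (LP.length-map (run r d) (toList d)) (VP.length-toList d)) ⟩
      length (injectiveWords k) * k  ≡⟨ cong (_* k) (injectiveWords-length k) ⟩
      fall m k * k                   ≡⟨ *-comm (fall m k) k ⟩
      k * fall m k                   ∎

mainTheorem2 : (m n k : ℕ) → 1 ≤ m → k ≤ m → k ≤ n →
    (k < n → HasCount (Good m n k) (k * fall m k)) ×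
    (k ≡ n → HasCount (Good m n k) (fall m n))
mainTheorem2 m n k _ _ _ = fewerLetters , allDistinct
  where
  open Words m
  fewerLetters : k < n → HasCount (Good m n k) (k * fall m k)
  fewerLetters k<n with m≤n⇒∃[o]m+o≡n k<n
  ... | r , 1+k+r≡n =
    subst (λ t → HasCount (Good m t k) (k * fall m k)) (trans (+-suc k r) 1+k+r≡n) (count-run k r)
  allDistinct : k ≡ n → HasCount (Good m n k) (fall m n)
  allDistinct k≡n = subst (λ t → HasCount (Good m t k) (fall m t)) k≡n (count-injective k)
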